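{- Let $k\geq 3$, let $\widehat G$ be a finite simple graph, let $d$ be a positive integer, and let $f\in\mathcal{F}_d(\widehat G^{(k)})$ be such that the multi-digraph $D=D_f$ is Eulerian. Write $m_D(v,u)$ for the multiplicity of the arc $(v,u)$ in $D$. Let $\{i,j\}\in E(\widehat G)$. Then $m_D(v,u)=m_D(v,u')$ for any three distinct vertices $v,u,u'$ of the hyperedge $\{i,j\}^{(k)}$, and $m_D(i,j)+m_D(j,i)=2m_D(v,i)=2m_D(v,j)$ for every core vertex $v$ of $\{i,j\}^{(k)}$.
   Context: $\widehat G^{(k)}$ is the $k$-uniform hypergraph obtained from $\widehat G$ by adding to each edge $\{i,j\}$ a set $\mathcal{N}_{ij}$ of $k-2$ new vertices (core vertices), distinct for distinct edges; the hyperedge is $\{i,j\}^{(k)}=\{i,j\}\cup\mathcal{N}_{ij}$. Fix a labelling of the vertices of $\widehat G^{(k)}$ by $1,\ldots,n$. $\mathcal{F}_d(\widehat G^{(k)})$ is the set of $d$-tuples $f=(i_1\alpha_1,\ldots,i_d\alpha_d)$ with $i_1\le\cdots\le i_d$, where each $i_j\alpha_j=(i_j,v^{(j)}_1,\ldots,v^{(j)}_{k-1})$ is a sequence whose underlying set $e_j=\{i_j,v^{(j)}_1,\ldots,v^{(j)}_{k-1}\}$ is a hyperedge of $\widehat G^{(k)}$, and such that $\{e_1,\ldots,e_d\}$ is the full set of hyperedges of $\widehat G^{(k)}$. $D_f$ is the multi-digraph on the vertex set of $\widehat G^{(k)}$ whose multiset of arcs is the union over $j$ of the arcs $(i_j,v^{(j)}_1),\ldots,(i_j,v^{(j)}_{k-1})$.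 A multi-digraph is Eulerian if it has a closed walk traversing every arc exactly once (counting multiplicity). -}

module Defs where

open import Data.Nat using (ℕ; zero; suc; _+_; _∸_)
open import Data.Fin using (Fin; _<_; _≤_)
open import Data.Fin.Properties using () renaming (_≟_ to _≟F_)
open import Data.List using (List; []; _∷_; length; filter; concatMap; map)
open import Data.List.Relation.Unary.All using (All)
open import Data.List.Relation.Unary.Unique.Propositional using (Unique)
open import Data.Vec using (Vec; toList)
open import Data.Vec.Membership.Propositional using () renaming (_∈_ to _∈ᵥ_)
open import Data.Product using (Σ; ∃; _×_; _,_; proj₁; proj₂)
open import Data.Sum using (_⊎_; inj₁; inj₂)
open import Data.Sum.Properties using () renaming (≡-dec to ⊎-≡-dec)
open import Data.Product.Properties using () renaming (≡-dec to ×-≡-dec)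
open import Relation.Binary.PropositionalEquality using (_≡_)
open import Relation.Binary.Definitions using (DecidableEquality)
open import Data.List.Relation.Binary.Permutation.Propositional using (_↭_)
open import Function.Bundles using (_⤖_; Bijection; _⇔_)

-- Its edge set is given
-- canonically as a duplicate-free list of pairs (i , j) with i < j; the pair
-- (i , j) represents the unordered edge {i , j}.
record SimpleGraph : Set where
  field
    m       : ℕ
    E       : List (Fin m × Fin m)
    ordered : All (λ p → proj₁ p < proj₂ p) E
    unique  : Unique E
open SimpleGraph public

Edge : SimpleGraph → Set
Edge G = Fin (length (E G))

endpoints : (G : SimpleGraph) → Edge G → Fin (m G) × Fin (m G)
endpoints G e = Data.List.lookup (E G) e

-- Vertex set of Ĝ^(k): original vertices, plus for each edge e a set
-- N_e of k-2 new (core) vertices  (e , t), t : Fin (k ∸ 2).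
V : SimpleGraph → ℕ → Set
V G k = Fin (m G) ⊎ (Edge G × Fin (k ∸ 2))

_≟V_ : {G : SimpleGraph} {k : ℕ} → DecidableEquality (V G k)
_≟V_ = ⊎-≡-dec _≟F_ (×-≡-dec _≟F_ _≟F_)

orig : (G : SimpleGraph) (k : ℕ) → Fin (m G) → V G k
orig G k i = inj₁ i

InHyperedge : (G : SimpleGraph) (k : ℕ) → Edge G → V G k → Set
InHyperedge G k e v =
  (v ≡ inj₁ (proj₁ (endpoints G e))) ⊎
  ((v ≡ inj₁ (proj₂ (endpoints G e))) ⊎
   (Σ (Fin (k ∸ 2)) λ t → v ≡ inj₂ (e , t)))

IsCore : (G : SimpleGraph) (k : ℕ) → Edge G → V G k → Set
IsCore G k e v = Σ (Fin (k ∸ 2)) λ t → v ≡ inj₂ (e , t)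

-- A sequence iα = (i, v₁, …, v_{k-1}): head i and tail α.
Seq : SimpleGraph → ℕ → Set
Seq G k = V G k × Vec (V G k) (k ∸ 1)

UnderlyingIs : (G : SimpleGraph) (k : ℕ) → Seq G k → Edge G → Set
UnderlyingIs G k (i , α) e =
  (v : V G k) → ((v ≡ i) ⊎ (v ∈ᵥ α)) ⇔ InHyperedge G k e v

Labelling : SimpleGraph → ℕ → ℕ → Set
Labelling G k n = V G k ⤖ Fin n

InF : (G : SimpleGraph) (k n d : ℕ) → Labelling G k n →
      Vec (Seq G k) d → Set
InF G k n d L f =
  ((a b : Fin d) → a ≤ b →
     Bijection.to L (proj₁ (Data.Vec.lookup f a))
       ≤ Bijection.to L (proj₁ (Data.Vec.lookup f b))) ×
  (((a : Fin d) → ∃ λ e → UnderlyingIs G k (Data.Vec.lookup f a) e) ×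
   ((e : Edge G) → ∃ λ a → UnderlyingIs G k (Data.Vec.lookup f a) e))

-- Arcs of D_f, as a list (multiset): for each j the arcs (i_j , v) for v in α_j.
Arc : SimpleGraph → ℕ → Set
Arc G k = V G k × V G k

arcs : (G : SimpleGraph) (k d : ℕ) → Vec (Seq G k) d → List (Arc G k)
arcs G k d f = concatMap (λ s → map (λ u → (proj₁ s , u)) (toList (proj₂ s))) (toList f)

mult : (G : SimpleGraph) (k : ℕ) → List (Arc G k) → V G k → V G k → ℕ
mult G k as v u = length (filter (λ a → ×-≡-dec (_≟V_ {G} {k}) (_≟V_ {G} {k}) a (v , u)) as)

WalkFromTo : {A : Set} → A → List (A × A) → A → Set
WalkFromTo x []             y = x ≡ y
WalkFromTo x ((a , b) ∷ ws) y = (x ≡ a) × WalkFromTo b ws y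

Eulerian : {A : Set} → List (A × A) → Set
Eulerian {A} as = Σ (List (A × A)) λ ws → (ws ↭ as) × (Σ A λ x → WalkFromTo x ws x)

-- Two hyperedges of Ĝ^(k) share at most one vertex, and the k entries of a sequence
-- spanning a hyperedge are exactly its k vertices, each once.  Hence for distinct v, u in
-- {i,j}^(k), m_D(v,u) is the number of sequences of f spanning {i,j}^(k) with head v,
-- whatever u is.  A core vertex v lies in no other hyperedge, so its out-degree in D is
-- (k-1)·m_D(v,i) and its in-degree is the number of sequences spanning {i,j}^(k) with head
-- other than v.  In an Eulerian digraph these agree, so k·m_D(v,i) = N, the number of
-- sequences spanning {i,j}^(k).  The k-2 cores thus head N/k sequences each, leaving
-- 2N/k = m_D(i,j) + m_D(j,i) headed at i or j.

module Submission where

open import Defs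
open import Data.Empty using (⊥-elim)
open import Data.Fin as Fin using (Fin; zero; suc; punchIn)
import Data.Fin.Properties as Finₚ
open import Data.List as List using (List; []; _∷_; length; filter; concatMap; map; _++_)
open import Data.List.Membership.Propositional using (_∈_; _∉_)
open import Data.List.Membership.Propositional.Properties using (∈-lookup)
open import Data.List.Properties using (length-++; filter-++; filter-all; filter-none; filter-some; filter-≐)
open import Data.List.Relation.Unary.All as All using (All)
open import Data.List.Relation.Unary.Any as Any using ()
open import Data.List.Relation.Unary.AllPairs using (_∷_)
open import Data.List.Relation.Unary.Unique.Propositional using (Unique)
open import Data.List.Relation.Binary.Permutation.Propositional using (↭-sym)
open import Data.List.Relation.Binary.Permutation.Propositional.Properties using (↭-length; filter-↭)
open import Data.Nat using (ℕ; zero; suc; _+_; _*_; _≤_; z≤n; s≤s)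
open import Data.Nat.Properties hiding (_≟_)
open import Algebra.Properties.Semiring.Sum +-*-semiring
  using (sum-syntax; sum-cong-≗; sum-remove; sum-replicate-zero; ∑-distrib-+; ∑-comm; *-distribˡ-sum)
open import Data.Product using (∃; _×_; _,_; proj₁; proj₂)
open import Data.Product.Properties using (,-injectiveʳ) renaming (≡-dec to ×-≡-dec)
open import Data.Sum using (_⊎_; inj₁; inj₂)
open import Data.Sum.Properties using (inj₁-injective; inj₂-injective)
open import Data.Vec as Vec using (Vec; toList)
open import Data.Vec.Properties using (length-toList)
open import Data.Vec.Membership.Propositional.Properties using (∈-toList⁺; ∈-toList⁻)
open import Function using (_∘_; Injective; Equivalence)
open import Relation.Binary.Definitions using (DecidableEquality)
open import Relation.Binary.PropositionalEquality
open import Relation.Nullary using (Dec; yes; no; ¬_)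
open import Relation.Unary using (Pred; Decidable)

𝟙 : ∀ {p} {P : Set p} → Dec P → ℕ
𝟙 (yes _) = 1
𝟙 (no _)  = 0

𝟙-yes : ∀ {p} {P : Set p} (P? : Dec P) → P → 𝟙 P? ≡ 1
𝟙-yes (yes _) _ = refl
𝟙-yes (no ¬p) p = ⊥-elim (¬p p)

𝟙-no : ∀ {p} {P : Set p} (P? : Dec P) → ¬ P → 𝟙 P? ≡ 0
𝟙-no (yes p) ¬p = ⊥-elim (¬p p)
𝟙-no (no _)  _  = refl

∑-const : ∀ n x → ∑[ i < n ] x ≡ n * x
∑-const zero    x = refl
∑-const (suc n) x = cong (x +_) (∑-const n x)

∑-zero : ∀ {n} (g : Fin n → ℕ) → (∀ i → g i ≡ 0) → ∑[ i < n ] g i ≡ 0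
∑-zero {n} g g≡0 = trans (sum-cong-≗ g≡0) (sum-replicate-zero n)

term≤∑ : ∀ {n} (g : Fin n → ℕ) i → g i ≤ ∑[ j < n ] g j
term≤∑ {suc n} g i = ≤-trans (m≤m+n (g i) _) (≤-reflexive (sym (sum-remove {i = i} g)))

n≤∑ : ∀ {n} (g : Fin n → ℕ) → (∀ i → 1 ≤ g i) → n ≤ ∑[ i < n ] g i
n≤∑ {zero}  g _   = z≤n
n≤∑ {suc n} g g≥1 = +-mono-≤ (g≥1 zero) (n≤∑ (g ∘ suc) (g≥1 ∘ suc))

all≥1∧∑≤n⇒all≡1 : ∀ {n} (g : Fin n → ℕ) → (∀ i → 1 ≤ g i) → ∑[ i < n ] g i ≤ n → ∀ i → g i ≡ 1
all≥1∧∑≤n⇒all≡1 {suc n} g g≥1 ∑≤n i = ≤-antisym (+-cancelʳ-≤ n (g i) 1 gi+n≤1+n) (g≥1 i)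
  where
  open ≤-Reasoning
  gi+n≤1+n : g i + n ≤ 1 + n
  gi+n≤1+n = begin
    g i + n                        ≤⟨ +-monoʳ-≤ (g i) (n≤∑ (g ∘ punchIn i) (g≥1 ∘ punchIn i)) ⟩
    g i + ∑[ j < n ] g (punchIn i j) ≡⟨ sum-remove g ⟨
    ∑[ j < suc n ] g j             ≤⟨ ∑≤n ⟩
    suc n                          ∎

equal-core-shares : ∀ {c} (h : Fin (2 + c) → ℕ) →
  (∀ t → (2 + c) * h (suc (suc t)) ≡ ∑[ i < 2 + c ] h i) →
  ∀ t → h zero + h (suc zero) ≡ 2 * h (suc (suc t))
equal-core-shares {c} h total t = +-cancelʳ-≡ (c * g t) (h zero + h (suc zero)) (2 * g t) (begin
    h zero + h (suc zero) + c * g t      ≡⟨ +-assoc (h zero) (h (suc zero)) (c * g t) ⟩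
    h zero + (h (suc zero) + c * g t)    ≡⟨ cong (λ x → h zero + (h (suc zero) + x)) ∑g≡c*gt ⟨
    ∑[ i < 2 + c ] h i                   ≡⟨ total t ⟨
    (2 + c) * g t                        ≡⟨ *-distribʳ-+ (g t) 2 c ⟩
    2 * g t + c * g t                    ∎)
  where
  open ≡-Reasoning
  g : Fin c → ℕ
  g i = h (suc (suc i))
  ∑g≡c*gt : ∑[ i < c ] g i ≡ c * g t
  ∑g≡c*gt = trans (sum-cong-≗ (λ i → *-cancelˡ-≡ (g i) (g t) (2 + c) (trans (total i) (sym (total t)))))
                  (∑-const c (g t))

length-filter-∷ : ∀ {a p} {A : Set a} {P : Pred A p} (P? : Decidable P) x xs →
  length (filter P? (x ∷ xs)) ≡ 𝟙 (P? x) + length (filter P? xs)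
length-filter-∷ P? x xs with P? x
... | yes _ = refl
... | no _  = refl

module _ {a p} {A : Set a} {P : Pred A p} (P? : Decidable P) where

  length-filter-map : ∀ {B : Set} (g : B → A) xs → length (filter P? (map g xs)) ≡ length (filter (P? ∘ g) xs)
  length-filter-map g []       = refl
  length-filter-map g (x ∷ xs) = begin
    length (filter P? (g x ∷ map g xs))          ≡⟨ length-filter-∷ P? (g x) (map g xs) ⟩
    𝟙 (P? (g x)) + length (filter P? (map g xs)) ≡⟨ cong (𝟙 (P? (g x)) +_) (length-filter-map g xs) ⟩
    𝟙 (P? (g x)) + length (filter (P? ∘ g) xs)   ≡⟨ length-filter-∷ (P? ∘ g) x xs ⟨
    length (filter (P? ∘ g) (x ∷ xs))            ∎
    where open ≡-Reasoning

  length-filter-concatMap : ∀ {B : Set} (g : B → List A) {d} (xs : Vec B d) →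
    length (filter P? (concatMap g (toList xs))) ≡ ∑[ i < d ] length (filter P? (g (Vec.lookup xs i)))
  length-filter-concatMap g Vec.[]       = refl
  length-filter-concatMap g (x Vec.∷ xs) = begin
    length (filter P? (g x ++ concatMap g (toList xs)))
      ≡⟨ cong length (filter-++ P? (g x) _) ⟩
    length (filter P? (g x) ++ filter P? (concatMap g (toList xs)))
      ≡⟨ length-++ (filter P? (g x)) ⟩
    length (filter P? (g x)) + length (filter P? (concatMap g (toList xs)))
      ≡⟨ cong (length (filter P? (g x)) +_) (length-filter-concatMap g xs) ⟩
    length (filter P? (g x)) + ∑[ i < _ ] length (filter P? (g (Vec.lookup xs i)))
      ∎
    where open ≡-Reasoning

length-filter-const : ∀ {a p} {A : Set a} {P : Set p} (P? : Dec P) (xs : List A) →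
  length (filter (λ _ → P?) xs) ≡ 𝟙 P? * length xs
length-filter-const (yes p) xs = trans (cong length (filter-all (λ _ → yes p) (All.universal (λ _ → p) xs)))
                                       (sym (*-identityˡ (length xs)))
length-filter-const (no ¬p) xs = cong length (filter-none (λ _ → no ¬p) (All.universal (λ _ → ¬p) xs))

lookup-injective : ∀ {a} {A : Set a} {xs : List A} → Unique xs →
  ∀ {i j} → List.lookup xs i ≡ List.lookup xs j → i ≡ j
lookup-injective {xs = x ∷ xs} _         {zero}  {zero}  _  = refl
lookup-injective {xs = x ∷ xs} (x∉ ∷ _)  {zero}  {suc j} eq = ⊥-elim (All.lookup x∉ (∈-lookup j) eq)
lookup-injective {xs = x ∷ xs} (x∉ ∷ _)  {suc i} {zero}  eq = ⊥-elim (All.lookup x∉ (∈-lookup i) (sym eq))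
lookup-injective {xs = x ∷ xs} (_ ∷ xs!) {suc i} {suc j} eq = cong suc (lookup-injective xs! eq)

module Counting {A : Set} (_≟_ : DecidableEquality A) where

  count : A → List A → ℕ
  count x xs = length (filter (_≟ x) xs)

  count-∷ : ∀ x y ys → count y (x ∷ ys) ≡ 𝟙 (x ≟ y) + count y ys
  count-∷ x y ys = length-filter-∷ (_≟ y) x ys

  count-pos : ∀ {x xs} → x ∈ xs → 1 ≤ count x xs
  count-pos x∈xs = filter-some (_≟ _) (Any.map sym x∈xs)

  count-≡0 : ∀ {x xs} → x ∉ xs → count x xs ≡ 0
  count-≡0 {x} x∉xs = cong length (filter-none (_≟ x) (All.tabulate (λ y∈xs y≡x → x∉xs (subst (_∈ _) y≡x y∈xs))))

  ∑𝟙≤1 : ∀ {n} {ι : Fin n → A} → Injective _≡_ _≡_ ι → ∀ x → ∑[ t < n ] 𝟙 (x ≟ ι t) ≤ 1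
  ∑𝟙≤1 {zero}      _     _ = z≤n
  ∑𝟙≤1 {suc n} {ι} ι-inj x with x ≟ ι zero
  ... | yes refl = ≤-reflexive (cong suc (∑-zero _ (λ t → 𝟙-no (ι zero ≟ ι (suc t)) (Finₚ.0≢1+n ∘ ι-inj))))
  ... | no _     = ∑𝟙≤1 (Finₚ.suc-injective ∘ ι-inj) x

  module _ {n} {ι : Fin n → A} (ι-injective : Injective _≡_ _≡_ ι) where

    ∑𝟙≡1 : ∀ {x t} → ι t ≡ x → ∑[ t′ < n ] 𝟙 (x ≟ ι t′) ≡ 1
    ∑𝟙≡1 {t = t} refl = ≤-antisym (∑𝟙≤1 ι-injective (ι t))
      (≤-trans (≤-reflexive (sym (𝟙-yes (ι t ≟ ι t) refl))) (term≤∑ (λ t′ → 𝟙 (ι t ≟ ι t′)) t))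

    ∑count≤length : ∀ xs → ∑[ t < n ] count (ι t) xs ≤ length xs
    ∑count≤length []       = ≤-reflexive (sum-replicate-zero n)
    ∑count≤length (x ∷ xs) = begin
      ∑[ t < n ] count (ι t) (x ∷ xs)                        ≡⟨ sum-cong-≗ (λ t → count-∷ x (ι t) xs) ⟩
      ∑[ t < n ] (𝟙 (x ≟ ι t) + count (ι t) xs)              ≡⟨ ∑-distrib-+ (λ t → 𝟙 (x ≟ ι t)) (λ t → count (ι t) xs) ⟩
      ∑[ t < n ] 𝟙 (x ≟ ι t) + ∑[ t < n ] count (ι t) xs     ≤⟨ +-mono-≤ (∑𝟙≤1 ι-injective x) (∑count≤length xs) ⟩
      suc (length xs)                                        ∎
      where open ≤-Reasoning

    count≡1-of-covering : ∀ {xs} → length xs ≡ n → (∀ t → ι t ∈ xs) → ∀ t → count (ι t) xs ≡ 1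
    count≡1-of-covering {xs} len covers = all≥1∧∑≤n⇒all≡1 (λ t → count (ι t) xs) (count-pos ∘ covers)
      (≤-trans (∑count≤length xs) (≤-reflexive len))

module Digraph {A : Set} (_≟_ : DecidableEquality A) where

  open Counting _≟_

  multiplicity : A → A → List (A × A) → ℕ
  multiplicity v u as = length (filter (λ a → ×-≡-dec _≟_ _≟_ a (v , u)) as)

  outDegree inDegree : A → List (A × A) → ℕ
  outDegree v as = length (filter (λ a → proj₁ a ≟ v) as)
  inDegree  v as = length (filter (λ a → proj₂ a ≟ v) as)

  walk-balance : ∀ {x ws y} → WalkFromTo x ws y → ∀ v → outDegree v ws + 𝟙 (y ≟ v) ≡ inDegree v ws + 𝟙 (x ≟ v)
  walk-balance {ws = []}               refl          v = refl
  walk-balance {ws = (a , b) ∷ ws} {y} (refl , walk) v = begin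
    outDegree v ((a , b) ∷ ws) + 𝟙 (y ≟ v)   ≡⟨ cong (_+ 𝟙 (y ≟ v)) (length-filter-∷ (λ a → proj₁ a ≟ v) (a , b) ws) ⟩
    𝟙 (a ≟ v) + outDegree v ws + 𝟙 (y ≟ v)   ≡⟨ +-assoc (𝟙 (a ≟ v)) _ _ ⟩
    𝟙 (a ≟ v) + (outDegree v ws + 𝟙 (y ≟ v)) ≡⟨ cong (𝟙 (a ≟ v) +_) (walk-balance walk v) ⟩
    𝟙 (a ≟ v) + (inDegree v ws + 𝟙 (b ≟ v))  ≡⟨ +-comm (𝟙 (a ≟ v)) _ ⟩
    inDegree v ws + 𝟙 (b ≟ v) + 𝟙 (a ≟ v)    ≡⟨ cong (_+ 𝟙 (a ≟ v)) (+-comm (inDegree v ws) _) ⟩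
    𝟙 (b ≟ v) + inDegree v ws + 𝟙 (a ≟ v)    ≡⟨ cong (_+ 𝟙 (a ≟ v)) (length-filter-∷ (λ a → proj₂ a ≟ v) (a , b) ws) ⟨
    inDegree v ((a , b) ∷ ws) + 𝟙 (a ≟ v)    ∎
    where open ≡-Reasoning

  eulerian⇒balanced : ∀ {as} → Eulerian as → ∀ v → outDegree v as ≡ inDegree v as
  eulerian⇒balanced {as} (ws , ws↭as , x , walk) v = begin
    outDegree v as ≡⟨ ↭-length (filter-↭ _ (↭-sym ws↭as)) ⟩
    outDegree v ws ≡⟨ +-cancelʳ-≡ (𝟙 (x ≟ v)) _ _ (walk-balance walk v) ⟩
    inDegree v ws  ≡⟨ ↭-length (filter-↭ _ ws↭as) ⟩
    inDegree v as  ∎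
    where open ≡-Reasoning

  star : ∀ {n} → A × Vec A n → List (A × A)
  star s = map (proj₁ s ,_) (toList (proj₂ s))

  starMultiplicity : ∀ {n} → A × Vec A n → A → A → ℕ
  starMultiplicity s v u = 𝟙 (proj₁ s ≟ v) * count u (toList (proj₂ s))

  multiplicity-star : ∀ {n} (s : A × Vec A n) v u → multiplicity v u (star s) ≡ starMultiplicity s v u
  multiplicity-star (h , α) v u with h ≟ v
  ... | yes refl = trans (length-filter-map _ (h ,_) (toList α))
                         (trans (cong length (filter-≐ _ _ (,-injectiveʳ , cong (h ,_)) (toList α)))
                                (sym (*-identityˡ _)))
  ... | no h≢v   = trans (length-filter-map _ (h ,_) (toList α))
                         (cong length (filter-none _ (All.universal (λ _ → h≢v ∘ cong proj₁) (toList α))))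

  outDegree-star : ∀ {n} (s : A × Vec A n) v → outDegree v (star s) ≡ 𝟙 (proj₁ s ≟ v) * n
  outDegree-star (h , α) v = trans (length-filter-map _ (h ,_) (toList α))
    (trans (length-filter-const (h ≟ v) (toList α)) (cong (𝟙 (h ≟ v) *_) (length-toList α)))

  inDegree-star : ∀ {n} (s : A × Vec A n) v → inDegree v (star s) ≡ count v (toList (proj₂ s))
  inDegree-star (h , α) v = length-filter-map _ (h ,_) (toList α)

  module _ {n d} (f : Vec (A × Vec A n) d) where

    stars : List (A × A)
    stars = concatMap star (toList f)

    multiplicity-stars : ∀ v u → multiplicity v u stars ≡ ∑[ i < d ] starMultiplicity (Vec.lookup f i) v u
    multiplicity-stars v u = trans (length-filter-concatMap _ star f) (sum-cong-≗ (λ i → multiplicity-star (Vec.lookup f i) v u))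

    outDegree-stars : ∀ v → outDegree v stars ≡ ∑[ i < d ] (𝟙 (proj₁ (Vec.lookup f i) ≟ v) * n)
    outDegree-stars v = trans (length-filter-concatMap _ star f) (sum-cong-≗ (λ i → outDegree-star (Vec.lookup f i) v))

    inDegree-stars : ∀ v → inDegree v stars ≡ ∑[ i < d ] count v (toList (proj₂ (Vec.lookup f i)))
    inDegree-stars v = trans (length-filter-concatMap _ star f) (sum-cong-≗ (λ i → inDegree-star (Vec.lookup f i) v))

sorted-pair-determined : ∀ {n} {x₁ x₂ y₁ y₂ a b : Fin n} → x₁ Fin.< x₂ → y₁ Fin.< y₂ → a ≢ b →
  a ≡ x₁ ⊎ a ≡ x₂ → b ≡ x₁ ⊎ b ≡ x₂ → a ≡ y₁ ⊎ a ≡ y₂ → b ≡ y₁ ⊎ b ≡ y₂ → (x₁ , x₂) ≡ (y₁ , y₂)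
sorted-pair-determined _  _  a≢b (inj₁ refl) (inj₁ refl) _           _           = ⊥-elim (a≢b refl)
sorted-pair-determined _  _  a≢b (inj₂ refl) (inj₂ refl) _           _           = ⊥-elim (a≢b refl)
sorted-pair-determined _  _  a≢b _           _           (inj₁ refl) (inj₁ refl) = ⊥-elim (a≢b refl)
sorted-pair-determined _  _  a≢b _           _           (inj₂ refl) (inj₂ refl) = ⊥-elim (a≢b refl)
sorted-pair-determined _  _  _   (inj₁ refl) (inj₂ refl) (inj₁ refl) (inj₂ refl) = refl
sorted-pair-determined _  _  _   (inj₂ refl) (inj₁ refl) (inj₂ refl) (inj₁ refl) = refl
sorted-pair-determined x< y< _   (inj₁ refl) (inj₂ refl) (inj₂ refl) (inj₁ refl) = ⊥-elim (Finₚ.<-asym x< y<)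
sorted-pair-determined x< y< _   (inj₂ refl) (inj₁ refl) (inj₁ refl) (inj₂ refl) = ⊥-elim (Finₚ.<-asym x< y<)

-- Pairs each vertex of a hyperedge with a different one, so that the sum over t of
-- m_D(vertex t, vertex (partner t)) counts every sequence spanning the hyperedge once, by its head.
partner : ∀ {c} → Fin (2 + c) → Fin (2 + c)
partner zero    = suc zero
partner (suc _) = zero

partner-≢ : ∀ {c} (t : Fin (2 + c)) → t ≢ partner t
partner-≢ zero    ()
partner-≢ (suc _) ()

module Hypergraph (G : SimpleGraph) (c : ℕ) where

  Vertex : Set
  Vertex = V G (2 + c)

  _≟_ : DecidableEquality Vertex
  _≟_ = _≟V_ {G} {2 + c}

  open Counting _≟_
  open Digraph _≟_

  Member : Edge G → Vertex → Set
  Member = InHyperedge G (2 + c)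

  i₀ j₀ : Edge G → Fin (m G)
  i₀ e = proj₁ (endpoints G e)
  j₀ e = proj₂ (endpoints G e)

  i₀<j₀ : ∀ e → i₀ e Fin.< j₀ e
  i₀<j₀ e = All.lookup (ordered G) (∈-lookup e)

  vertex : Edge G → Fin (2 + c) → Vertex
  vertex e zero          = inj₁ (i₀ e)
  vertex e (suc zero)    = inj₁ (j₀ e)
  vertex e (suc (suc t)) = inj₂ (e , t)

  vertex-injective : ∀ e → Injective _≡_ _≡_ (vertex e)
  vertex-injective e {zero}          {zero}          _  = refl
  vertex-injective e {zero}          {suc zero}      eq = ⊥-elim (Finₚ.<-irrefl (inj₁-injective eq) (i₀<j₀ e))
  vertex-injective e {suc zero}      {zero}          eq = ⊥-elim (Finₚ.<-irrefl (inj₁-injective (sym eq)) (i₀<j₀ e))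
  vertex-injective e {suc zero}      {suc zero}      _  = refl
  vertex-injective e {suc (suc t)}   {suc (suc t′)}  eq = cong (λ t → suc (suc t)) (,-injectiveʳ (inj₂-injective eq))
  vertex-injective e {zero}          {suc (suc _)}   ()
  vertex-injective e {suc zero}      {suc (suc _)}   ()
  vertex-injective e {suc (suc _)}   {zero}          ()
  vertex-injective e {suc (suc _)}   {suc zero}      ()

  vertex-member : ∀ e t → Member e (vertex e t)
  vertex-member e zero          = inj₁ refl
  vertex-member e (suc zero)    = inj₂ (inj₁ refl)
  vertex-member e (suc (suc t)) = inj₂ (inj₂ (t , refl))

  member⇒vertex : ∀ {e v} → Member e v → ∃ λ t → vertex e t ≡ v
  member⇒vertex (inj₁ refl)              = zero , refl
  member⇒vertex (inj₂ (inj₁ refl))       = suc zero , refl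
  member⇒vertex (inj₂ (inj₂ (t , refl))) = suc (suc t) , refl

  core-member⇒edge : ∀ {e e′ t} → Member e′ (inj₂ (e , t)) → e′ ≡ e
  core-member⇒edge (inj₂ (inj₂ (_ , refl))) = refl

  original-member⇒endpoint : ∀ {e a} → Member e (inj₁ a) → a ≡ i₀ e ⊎ a ≡ j₀ e
  original-member⇒endpoint (inj₁ refl)       = inj₁ refl
  original-member⇒endpoint (inj₂ (inj₁ refl)) = inj₂ refl

  two-common-members⇒same-edge : ∀ {e e′ x y} → x ≢ y →
    Member e x → Member e y → Member e′ x → Member e′ y → e ≡ e′
  two-common-members⇒same-edge {x = inj₂ _} _ x∈e _ x∈e′ _ = trans (core-member⇒edge x∈e) (sym (core-member⇒edge x∈e′))
  two-common-members⇒same-edge {x = inj₁ _} {inj₂ _} _ _ y∈e _ y∈e′ = trans (core-member⇒edge y∈e) (sym (core-member⇒edge y∈e′))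
  two-common-members⇒same-edge {e} {e′} {inj₁ a} {inj₁ b} x≢y x∈e y∈e x∈e′ y∈e′ =
    lookup-injective (unique G) (sorted-pair-determined (i₀<j₀ e) (i₀<j₀ e′) (x≢y ∘ cong inj₁)
      (original-member⇒endpoint x∈e) (original-member⇒endpoint y∈e)
      (original-member⇒endpoint x∈e′) (original-member⇒endpoint y∈e′))

  Sequence : Set
  Sequence = Seq G (2 + c)

  Spans : Sequence → Edge G → Set
  Spans = UnderlyingIs G (2 + c)

  module _ {h α e} (spans : Spans (h , α) e) where

    head-member : Member e h
    head-member = Equivalence.to (spans h) (inj₁ refl)

    tail-member : ∀ {u} → u ∈ toList α → Member e u
    tail-member u∈α = Equivalence.to (spans _) (inj₂ (∈-toList⁻ u∈α))

    member⇒∈ : ∀ {u} → Member e u → u ∈ h ∷ toList α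
    member⇒∈ u∈e with Equivalence.from (spans _) u∈e
    ... | inj₁ refl = Any.here refl
    ... | inj₂ u∈α  = Any.there (∈-toList⁺ u∈α)

    member-count≡1 : ∀ {u} → Member e u → count u (h ∷ toList α) ≡ 1
    member-count≡1 u∈e with member⇒vertex u∈e
    ... | t , refl = count≡1-of-covering (vertex-injective e) (cong suc (length-toList α))
                                         (member⇒∈ ∘ vertex-member e) t

    tail-count≡1 : ∀ {u} → Member e u → u ≢ h → count u (toList α) ≡ 1
    tail-count≡1 {u} u∈e u≢h = begin
      count u (toList α)               ≡⟨ cong (_+ count u (toList α)) (𝟙-no (h ≟ u) (u≢h ∘ sym)) ⟨
      𝟙 (h ≟ u) + count u (toList α)   ≡⟨ count-∷ h u (toList α) ⟨
      count u (h ∷ toList α)           ≡⟨ member-count≡1 u∈e ⟩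
      1                                ∎
      where open ≡-Reasoning

  starMultiplicity-own : ∀ {h α e x y} → Spans (h , α) e → x ≢ y → Member e y →
    starMultiplicity (h , α) x y ≡ 𝟙 (h ≟ x)
  starMultiplicity-own {h} {x = x} spans x≢y y∈e with h ≟ x
  ... | yes refl = trans (*-identityˡ _) (tail-count≡1 spans y∈e (x≢y ∘ sym))
  ... | no _     = refl

  starMultiplicity-foreign : ∀ {h α e′ e x y} → Spans (h , α) e′ → e′ ≢ e → x ≢ y → Member e x → Member e y →
    starMultiplicity (h , α) x y ≡ 0
  starMultiplicity-foreign {h} {x = x} spans e′≢e x≢y x∈e y∈e with h ≟ x
  ... | yes refl = trans (*-identityˡ _) (count-≡0 (λ y∈α →
                     e′≢e (two-common-members⇒same-edge x≢y (head-member spans) (tail-member spans y∈α) x∈e y∈e)))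
  ... | no _     = refl

  starMultiplicity-uniform : ∀ {s e′ e x y y′} → Spans s e′ → x ≢ y → x ≢ y′ →
    Member e x → Member e y → Member e y′ → starMultiplicity s x y ≡ starMultiplicity s x y′
  starMultiplicity-uniform {e′ = e′} {e} spans x≢y x≢y′ x∈e y∈e y′∈e with e′ Finₚ.≟ e
  ... | yes refl = trans (starMultiplicity-own spans x≢y y∈e) (sym (starMultiplicity-own spans x≢y′ y′∈e))
  ... | no e′≢e  = trans (starMultiplicity-foreign spans e′≢e x≢y x∈e y∈e)
                         (sym (starMultiplicity-foreign spans e′≢e x≢y′ x∈e y′∈e))

  vertex-≢-partner : ∀ e t → vertex e t ≢ vertex e (partner t)
  vertex-≢-partner e t = partner-≢ t ∘ vertex-injective e

  module _ (e : Edge G) (t : Fin c) where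

    private
      core v₀ : Vertex
      core = vertex e (suc (suc t))
      v₀   = vertex e zero

    core-outDegree-share : ∀ {h α e′} → Spans (h , α) e′ →
      𝟙 (h ≟ core) * suc c ≡ suc c * starMultiplicity (h , α) core v₀
    core-outDegree-share {h} {α} {e′} spans with e′ Finₚ.≟ e
    ... | yes refl = trans (*-comm (𝟙 (h ≟ core)) (suc c))
                           (cong (suc c *_) (sym (starMultiplicity-own spans (λ ()) (vertex-member e zero))))
    ... | no e′≢e  = begin
      𝟙 (h ≟ core) * suc c                     ≡⟨ cong (_* suc c) (𝟙-no (h ≟ core) h≢core) ⟩
      0                                        ≡⟨ *-zeroʳ (suc c) ⟨
      suc c * 0                                ≡⟨ cong (suc c *_) foreign ⟨
      suc c * starMultiplicity (h , α) core v₀ ∎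
      where
      open ≡-Reasoning
      h≢core : h ≢ core
      h≢core h≡core = e′≢e (core-member⇒edge (subst (Member e′) h≡core (head-member spans)))
      foreign : starMultiplicity (h , α) core v₀ ≡ 0
      foreign = starMultiplicity-foreign spans e′≢e (λ ()) (vertex-member e _) (vertex-member e zero)

    -- Both sides are 1 if the sequence spans e and 0 otherwise.
    core-inDegree-share : ∀ {h α e′} → Spans (h , α) e′ →
      count core (toList α) + starMultiplicity (h , α) core v₀
        ≡ ∑[ t′ < 2 + c ] starMultiplicity (h , α) (vertex e t′) (vertex e (partner t′))
    core-inDegree-share {h} {α} {e′} spans with e′ Finₚ.≟ e
    ... | yes refl = begin
      count core (toList α) + starMultiplicity (h , α) core v₀
        ≡⟨ cong (count core (toList α) +_) (starMultiplicity-own spans (λ ()) (vertex-member e zero)) ⟩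
      count core (toList α) + 𝟙 (h ≟ core)
        ≡⟨ +-comm _ (𝟙 (h ≟ core)) ⟩
      𝟙 (h ≟ core) + count core (toList α)
        ≡⟨ count-∷ h core (toList α) ⟨
      count core (h ∷ toList α)
        ≡⟨ member-count≡1 spans (vertex-member e _) ⟩
      1
        ≡⟨ ∑𝟙≡1 (vertex-injective e) (proj₂ (member⇒vertex (head-member spans))) ⟨
      ∑[ t′ < 2 + c ] 𝟙 (h ≟ vertex e t′)
        ≡⟨ sum-cong-≗ (λ t′ → starMultiplicity-own spans (vertex-≢-partner e t′) (vertex-member e (partner t′))) ⟨
      ∑[ t′ < 2 + c ] starMultiplicity (h , α) (vertex e t′) (vertex e (partner t′))
        ∎
      where open ≡-Reasoning
    ... | no e′≢e  = begin
      count core (toList α) + starMultiplicity (h , α) core v₀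
        ≡⟨ cong₂ _+_ (count-≡0 (e′≢e ∘ core-member⇒edge ∘ tail-member spans))
                     (starMultiplicity-foreign spans e′≢e (λ ()) (vertex-member e _) (vertex-member e zero)) ⟩
      0
        ≡⟨ ∑-zero _ (λ t′ → starMultiplicity-foreign spans e′≢e (vertex-≢-partner e t′)
                               (vertex-member e t′) (vertex-member e (partner t′))) ⟨
      ∑[ t′ < 2 + c ] starMultiplicity (h , α) (vertex e t′) (vertex e (partner t′))
        ∎
      where open ≡-Reasoning

  module _ {d} (f : Vec Sequence d) (spans : ∀ i → ∃ λ e′ → Spans (Vec.lookup f i) e′) where

    -- The multiplicity m_D of the paper; it unfolds to mult G (2 + c) (arcs G (2 + c) d f).
    μ : Vertex → Vertex → ℕ
    μ x y = multiplicity x y (stars f)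

    μ-uniform : ∀ {e x y y′} → x ≢ y → x ≢ y′ → Member e x → Member e y → Member e y′ → μ x y ≡ μ x y′
    μ-uniform {x = x} {y} {y′} x≢y x≢y′ x∈e y∈e y′∈e = begin
      μ x y
        ≡⟨ multiplicity-stars f x y ⟩
      ∑[ i < d ] starMultiplicity (Vec.lookup f i) x y
        ≡⟨ sum-cong-≗ (λ i → starMultiplicity-uniform (proj₂ (spans i)) x≢y x≢y′ x∈e y∈e y′∈e) ⟩
      ∑[ i < d ] starMultiplicity (Vec.lookup f i) x y′
        ≡⟨ multiplicity-stars f x y′ ⟨
      μ x y′
        ∎
      where open ≡-Reasoning

    module _ (eulerian : Eulerian (stars f)) (e : Edge G) where

      private
        v₀ v₁ : Vertex
        v₀ = vertex e zero
        v₁ = vertex e (suc zero)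

      core-μ-balance : ∀ t → (2 + c) * μ (vertex e (suc (suc t))) v₀ ≡ ∑[ t′ < 2 + c ] μ (vertex e t′) (vertex e (partner t′))
      core-μ-balance t = begin
        (2 + c) * μ core v₀
          ≡⟨ +-comm (μ core v₀) (suc c * μ core v₀) ⟩
        suc c * μ core v₀ + μ core v₀
          ≡⟨ cong (_+ μ core v₀) outDegree≡ ⟩
        inDegree core (stars f) + μ core v₀
          ≡⟨ cong₂ _+_ (inDegree-stars f core) (multiplicity-stars f core v₀) ⟩
        ∑[ i < d ] count core (tail i) + ∑[ i < d ] starMultiplicity (Vec.lookup f i) core v₀
          ≡⟨ ∑-distrib-+ (λ i → count core (tail i)) (λ i → starMultiplicity (Vec.lookup f i) core v₀) ⟨
        ∑[ i < d ] (count core (tail i) + starMultiplicity (Vec.lookup f i) core v₀)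
          ≡⟨ sum-cong-≗ (λ i → core-inDegree-share e t (proj₂ (spans i))) ⟩
        ∑[ i < d ] ∑[ t′ < 2 + c ] starMultiplicity (Vec.lookup f i) (vertex e t′) (vertex e (partner t′))
          ≡⟨ ∑-comm (λ i t′ → starMultiplicity (Vec.lookup f i) (vertex e t′) (vertex e (partner t′))) ⟩
        ∑[ t′ < 2 + c ] ∑[ i < d ] starMultiplicity (Vec.lookup f i) (vertex e t′) (vertex e (partner t′))
          ≡⟨ sum-cong-≗ (λ t′ → multiplicity-stars f (vertex e t′) (vertex e (partner t′))) ⟨
        ∑[ t′ < 2 + c ] μ (vertex e t′) (vertex e (partner t′))
          ∎
        where
        open ≡-Reasoning
        core : Vertex
        core = vertex e (suc (suc t))
        tail : Fin d → List Vertex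
        tail i = toList (proj₂ (Vec.lookup f i))
        outDegree≡ : suc c * μ core v₀ ≡ inDegree core (stars f)
        outDegree≡ = begin
          suc c * μ core v₀
            ≡⟨ cong (suc c *_) (multiplicity-stars f core v₀) ⟩
          suc c * ∑[ i < d ] starMultiplicity (Vec.lookup f i) core v₀
            ≡⟨ *-distribˡ-sum (suc c) (λ i → starMultiplicity (Vec.lookup f i) core v₀) ⟩
          ∑[ i < d ] (suc c * starMultiplicity (Vec.lookup f i) core v₀)
            ≡⟨ sum-cong-≗ (λ i → core-outDegree-share e t (proj₂ (spans i))) ⟨
          ∑[ i < d ] (𝟙 (proj₁ (Vec.lookup f i) ≟ core) * suc c)
            ≡⟨ outDegree-stars f core ⟨
          outDegree core (stars f)
            ≡⟨ eulerian⇒balanced eulerian core ⟩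
          inDegree core (stars f)
            ∎

      core-μ : ∀ {v} → IsCore G (2 + c) e v → (μ v₀ v₁ + μ v₁ v₀ ≡ 2 * μ v v₀) × (μ v₀ v₁ + μ v₁ v₀ ≡ 2 * μ v v₁)
      core-μ (t , refl) = twice-v₀ , trans twice-v₀ (cong (2 *_) v₀-to-v₁)
        where
        twice-v₀ : μ v₀ v₁ + μ v₁ v₀ ≡ 2 * μ (vertex e (suc (suc t))) v₀
        twice-v₀ = equal-core-shares (λ t′ → μ (vertex e t′) (vertex e (partner t′))) core-μ-balance t
        v₀-to-v₁ : μ (vertex e (suc (suc t))) v₀ ≡ μ (vertex e (suc (suc t))) v₁
        v₀-to-v₁ = μ-uniform (λ ()) (λ ()) (vertex-member e _) (vertex-member e zero) (vertex-member e (suc zero))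

lemma4p1 : (k : ℕ) → 3 ≤ k → (G : SimpleGraph) → (n d : ℕ) → 1 ≤ d →
    (L : Labelling G k n) → (f : Vec (Seq G k) d) → InF G k n d L f →
    Eulerian (arcs G k d f) →
    (e : Edge G) →
    ((v u u' : V G k) →
       InHyperedge G k e v → InHyperedge G k e u → InHyperedge G k e u' →
       v ≢ u → v ≢ u' → u ≢ u' →
       mult G k (arcs G k d f) v u ≡ mult G k (arcs G k d f) v u')
    ×
    ((v : V G k) → IsCore G k e v →
       let i = orig G k (proj₁ (endpoints G e))
           j = orig G k (proj₂ (endpoints G e))
           D = arcs G k d f
       in (mult G k D i j + mult G k D j i ≡ 2 * mult G k D v i) × (mult G k D i j + mult G k D j i ≡ 2 * mult G k D v j))
lemma4p1 zero          ()
lemma4p1 (suc zero)    (s≤s ())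
lemma4p1 (suc (suc c)) _ G n d _ L f (_ , spans , _) eulerian e =
    (λ _ _ _ v∈e u∈e u′∈e v≢u v≢u′ _ → μ-uniform f spans v≢u v≢u′ v∈e u∈e u′∈e)
  , (λ _ → core-μ f spans eulerian e)
  where open Hypergraph G c
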